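{- Let $m\le n$ be positive integers. The number of $1$-metered $(m,n)$-parking functions in which the last car (car $m$) parks in spot $n$ equals $\mathrm{mpf}_{m-1,n}(1)$, with the convention $\mathrm{mpf}_{0,n}(1)=1$.
   Context: $[n]=\{1,\dots,n\}$. The $t$-metered parking scheme for $\alpha=(a_1,\dots,a_m)\in[n]^m$: there are $n$ spots $1,\dots,n$; cars $1,\dots,m$ arrive in order; car $i$ drives to spot $a_i$, parks there if unoccupied, and otherwise parks in the first unoccupied spot numbered greater than $a_i$; if there is none, the car fails to park. Immediately after car $j$ parks, car $j-t$ (if $j-t\ge1$) leaves. $\alpha$ is a $t$-metered $(m,n)$-parking function if all $m$ cars park; $\mathrm{mpf}_{m,n}(t)$ is the number of such $\alpha\in[n]^m$. -}

module Defs where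

open import Data.Nat using (ℕ; zero; suc; _+_; _≤_; _<_; _≟_; _<ᵇ_)
open import Data.Bool using (Bool; true; false; if_then_else_)
open import Data.List using (List; []; _∷_; _++_; length; filter; concatMap; map)
open import Data.Bool.ListAction using (any)
open import Data.Fin using (Fin; toℕ)
open import Data.Fin.Base using ()
open import Data.List using (allFin)
open import Data.Vec using (Vec; []; _∷_; toList; last)
open import Data.Maybe using (Maybe; just; nothing)
open import Data.Product using (_×_; _,_)
open import Relation.Nullary.Decidable using (⌊_⌋)

occupied : ℕ → List ℕ → Bool
occupied s occ = any (λ x → ⌊ x ≟ s ⌋) occ

findSpot : (n : ℕ) → List ℕ → (s : ℕ) → (fuel : ℕ) → Maybe ℕ
findSpot n occ s zero = nothing
findSpot n occ s (suc k) =
  if n <ᵇ s then nothing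
  else (if occupied s occ then findSpot n occ (suc s) k else just s)

dropOld : ℕ → List ℕ → List ℕ
dropOld t [] = []
dropOld t (x ∷ xs) = if t <ᵇ length (x ∷ xs) then xs else x ∷ xs

-- t-metered parking: the state is the list of spots of cars currently parked,
-- oldest first. Car preferences are spot numbers in 1..n.
run : (t n : ℕ) → List ℕ → List ℕ → Maybe (List ℕ)
run t n present [] = just []
run t n present (a ∷ as) with findSpot n present a (suc n)
... | nothing = nothing
... | just s with run t n (dropOld t (present ++ (s ∷ []))) as
...   | nothing = nothing
...   | just ss = just (s ∷ ss)

prefs : ∀ {m n} → Vec (Fin n) m → List ℕ
prefs α = map (λ i → suc (toℕ i)) (toList α)

outcome : (t : ℕ) → ∀ {m n} → Vec (Fin n) m → Maybe (List ℕ)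
outcome t {n = n} α = run t n [] (prefs α)

isMPF : (t : ℕ) → ∀ {m n} → Vec (Fin n) m → Bool
isMPF t α with outcome t α
... | just _ = true
... | nothing = false

-- Last element of a list of spots (0 for empty list; unused there).
lastSpot : List ℕ → ℕ
lastSpot [] = 0
lastSpot (x ∷ []) = x
lastSpot (x ∷ y ∷ ys) = lastSpot (y ∷ ys)

isMPFLastAt : (t : ℕ) → ∀ {m n} → Vec (Fin n) m → Bool
isMPFLastAt t {n = n} α with outcome t α
... | just ss = ⌊ lastSpot ss ≟ n ⌋
... | nothing = false

allVecs : (m n : ℕ) → List (Vec (Fin n) m)
allVecs zero n = [] ∷ []
allVecs (suc m) n = concatMap (λ i → map (i ∷_) (allVecs m n)) (allFin n)

count : ∀ {m n} → (Vec (Fin n) m → Bool) → List (Vec (Fin n) m) → ℕ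
count p [] = 0
count p (x ∷ xs) = if p x then suc (count p xs) else count p xs

mpf : (m n t : ℕ) → ℕ
mpf m n t = count (isMPF t) (allVecs m n)

mpfLastAtN : (m n t : ℕ) → ℕ
mpfLastAtN m n t = count (isMPFLastAt t) (allVecs m n)

module Submission where

-- With t = 1 the state of the lot is just the spot p of the car that parked last (p = 0 for
-- the empty lot), so the numbers of continuations from state p are iterates of the linear
-- operator (T f)(p) = Σₐ f(next p a), where a car preferring a parks at a unless a = p, in
-- which case it takes p + 1 (or fails when p = n).  For 1 ≤ p < n one has
-- (T f)(p) + f(p) = (T f)(0) + f(p + 1), and summing this over p gives
-- (T² f)(0) + f(1) = n (T f)(0).  With L_k = Tᵏ[· = n] and N_k = Tᵏ 1, a simultaneous
-- induction on k driven by these two identities shows L_{k+1}(p) = N_k(p) whenever 1 ≤ p and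
-- p + k + 2 ≤ n, and L_{k+1}(0) = N_k(0) whenever k < n; the latter is the theorem.

open import Defs
open import Data.Bool using (Bool; true; false; if_then_else_)
open import Data.Fin using (Fin; toℕ)
open import Data.Fin.Properties using (toℕ<n)
open import Data.List using (List; []; _∷_; _++_; map; concatMap; allFin; tabulate)
open import Data.List.Properties using (map-tabulate)
open import Data.Maybe using (Maybe; just; nothing; maybe′; _>>=_)
import Data.Maybe as Maybe
open import Data.Nat using (ℕ; zero; suc; _+_; _*_; _∸_; _≤_; _<_; _<ᵇ_; _≟_; z≤n; s≤s)
open import Data.Nat.GeneralisedArithmetic using (fold)
open import Data.Nat.ListAction using (sum)
open import Data.Nat.Properties
open import Data.Nat.Tactic.RingSolver using (solve-∀)
open import Data.Vec using (Vec; []; _∷_)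
open import Function using (_∘_)
open import Relation.Binary.PropositionalEquality
open import Relation.Nullary using (yes; no; contradiction)
open import Relation.Nullary.Decidable using (⌊_⌋)

-- f 1 + ⋯ + f n (the index starts at 1).
∑ : ℕ → (ℕ → ℕ) → ℕ
∑ zero    f = 0
∑ (suc n) f = f 1 + ∑ n (f ∘ suc)

∑-cong : ∀ n {f g : ℕ → ℕ} → (∀ a → 1 ≤ a → a ≤ n → f a ≡ g a) → ∑ n f ≡ ∑ n g
∑-cong zero    eq = refl
∑-cong (suc n) eq =
  cong₂ _+_ (eq 1 ≤-refl (s≤s z≤n)) (∑-cong n (λ a 1≤a a≤n → eq (suc a) (s≤s z≤n) (s≤s a≤n)))

∑-+ : ∀ n (f g : ℕ → ℕ) → ∑ n (λ a → f a + g a) ≡ ∑ n f + ∑ n g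
∑-+ zero    f g = refl
∑-+ (suc n) f g = begin
  f 1 + g 1 + ∑ n (λ a → f (suc a) + g (suc a))  ≡⟨ cong (f 1 + g 1 +_) (∑-+ n (f ∘ suc) (g ∘ suc)) ⟩
  f 1 + g 1 + (∑ n (f ∘ suc) + ∑ n (g ∘ suc))    ≡⟨ interchange (f 1) (g 1) _ _ ⟩
  f 1 + ∑ n (f ∘ suc) + (g 1 + ∑ n (g ∘ suc))    ∎
  where
  open ≡-Reasoning
  interchange : ∀ w x y z → w + x + (y + z) ≡ w + y + (x + z)
  interchange = solve-∀

∑-const : ∀ n c → ∑ n (λ _ → c) ≡ n * c
∑-const zero    c = refl
∑-const (suc n) c = cong (c +_) (∑-const n c)

∑-snoc : ∀ n f → ∑ (suc n) f ≡ ∑ n f + f (suc n)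
∑-snoc zero    f = +-comm (f 1) 0
∑-snoc (suc n) f = begin
  f 1 + ∑ (suc n) (f ∘ suc)              ≡⟨ cong (f 1 +_) (∑-snoc n (f ∘ suc)) ⟩
  f 1 + (∑ n (f ∘ suc) + f (suc (suc n))) ≡⟨ sym (+-assoc (f 1) _ _) ⟩
  f 1 + ∑ n (f ∘ suc) + f (suc (suc n))   ∎
  where open ≡-Reasoning

∑-exchange : ∀ n (f g : ℕ → ℕ) p → 1 ≤ p → p ≤ n → (∀ a → a ≢ p → f a ≡ g a) →
             ∑ n f + g p ≡ ∑ n g + f p
∑-exchange (suc n) f g 1 _ _ agree = begin
  f 1 + ∑ n (f ∘ suc) + g 1  ≡⟨ cong (λ s → f 1 + s + g 1) rest ⟩
  f 1 + ∑ n (g ∘ suc) + g 1  ≡⟨ swap-ends (f 1) _ (g 1) ⟩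
  g 1 + ∑ n (g ∘ suc) + f 1  ∎
  where
  open ≡-Reasoning
  rest : ∑ n (f ∘ suc) ≡ ∑ n (g ∘ suc)
  rest = ∑-cong n (λ a 1≤a _ → agree (suc a) (λ a+1≡1 → <⇒≢ (s≤s 1≤a) (sym a+1≡1)))
  swap-ends : ∀ x y z → x + y + z ≡ z + y + x
  swap-ends = solve-∀
∑-exchange (suc n) f g (suc (suc p)) _ (s≤s p<n) agree = begin
  f 1 + ∑ n (f ∘ suc) + g (2 + p)    ≡⟨ +-assoc (f 1) _ _ ⟩
  f 1 + (∑ n (f ∘ suc) + g (2 + p))  ≡⟨ cong₂ _+_ (agree 1 (λ ())) shifted ⟩
  g 1 + (∑ n (g ∘ suc) + f (2 + p))  ≡⟨ sym (+-assoc (g 1) _ _) ⟩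
  g 1 + ∑ n (g ∘ suc) + f (2 + p)    ∎
  where
  open ≡-Reasoning
  shifted : ∑ n (f ∘ suc) + g (2 + p) ≡ ∑ n (g ∘ suc) + f (2 + p)
  shifted = ∑-exchange n (f ∘ suc) (g ∘ suc) (suc p) (s≤s z≤n) p<n (λ a a≢p → agree (suc a) (a≢p ∘ suc-injective))

∑-single : ∀ n (f : ℕ → ℕ) p → 1 ≤ p → p ≤ n → (∀ a → a ≢ p → f a ≡ 0) → ∑ n f ≡ f p
∑-single n f p 1≤p p≤n vanish = begin
  ∑ n f               ≡⟨ +-identityʳ _ ⟨
  ∑ n f + 0           ≡⟨ ∑-exchange n f (λ _ → 0) p 1≤p p≤n vanish ⟩
  ∑ n (λ _ → 0) + f p ≡⟨ cong (_+ f p) (trans (∑-const n 0) (*-zeroʳ n)) ⟩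
  f p                 ∎
  where open ≡-Reasoning

∑-shift : ∀ n (f g : ℕ → ℕ) → 1 ≤ n → (∀ p → 1 ≤ p → p < n → g p ≡ f (suc p)) → g n ≡ 0 →
          ∑ n g + f 1 ≡ ∑ n f
∑-shift (suc n) f g _ shift last = begin
  ∑ (suc n) g + f 1          ≡⟨ cong (_+ f 1) (∑-snoc n g) ⟩
  ∑ n g + g (suc n) + f 1    ≡⟨ cong (λ s → ∑ n g + s + f 1) last ⟩
  ∑ n g + 0 + f 1            ≡⟨ cong (λ s → s + f 1) (+-identityʳ _) ⟩
  ∑ n g + f 1                ≡⟨ cong (_+ f 1) (∑-cong n (λ p 1≤p p≤n → shift p 1≤p (s≤s p≤n))) ⟩
  ∑ n (f ∘ suc) + f 1        ≡⟨ +-comm _ (f 1) ⟩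
  ∑ (suc n) f                ∎
  where open ≡-Reasoning

∑-allFin : ∀ n (f : ℕ → ℕ) → sum (map (λ i → f (suc (toℕ i))) (allFin n)) ≡ ∑ n f
∑-allFin n f = trans (cong sum (map-tabulate {n = n} (λ i → i) (λ i → f (suc (toℕ i))))) (sum-tabulate n f)
  where
  sum-tabulate : ∀ n (f : ℕ → ℕ) → sum (tabulate {n = n} (λ i → f (suc (toℕ i)))) ≡ ∑ n f
  sum-tabulate zero    f = refl
  sum-tabulate (suc n) f = cong (f 1 +_) (sum-tabulate n (f ∘ suc))

private variable
  k n : ℕ

count-cong : {P Q : Vec (Fin n) k → Bool} → (∀ α → P α ≡ Q α) → ∀ αs → count P αs ≡ count Q αs
count-cong eq []       = refl
count-cong eq (α ∷ αs) rewrite eq α | count-cong eq αs = refl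

count-false : (αs : List (Vec (Fin n) k)) → count (λ _ → false) αs ≡ 0
count-false []       = refl
count-false (_ ∷ αs) = count-false αs

count-++ : (P : Vec (Fin n) k → Bool) → ∀ αs βs → count P (αs ++ βs) ≡ count P αs + count P βs
count-++ P []       βs = refl
count-++ P (α ∷ αs) βs with P α
... | true  = cong suc (count-++ P αs βs)
... | false = count-++ P αs βs

count-map-∷ : (P : Vec (Fin n) (suc k) → Bool) (i : Fin n) → ∀ αs →
              count P (map (i ∷_) αs) ≡ count (P ∘ (i ∷_)) αs
count-map-∷ P i []       = refl
count-map-∷ P i (α ∷ αs) rewrite count-map-∷ P i αs = refl

count-concatMap-∷ : (P : Vec (Fin n) (suc k) → Bool) → ∀ αs is →
  count P (concatMap (λ i → map (i ∷_) αs) is) ≡ sum (map (λ i → count (P ∘ (i ∷_)) αs) is)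
count-concatMap-∷ P αs []       = refl
count-concatMap-∷ P αs (i ∷ is) = begin
  count P (map (i ∷_) αs ++ concatMap (λ i → map (i ∷_) αs) is)
    ≡⟨ count-++ P (map (i ∷_) αs) _ ⟩
  count P (map (i ∷_) αs) + count P (concatMap (λ i → map (i ∷_) αs) is)
    ≡⟨ cong₂ _+_ (count-map-∷ P i αs) (count-concatMap-∷ P αs is) ⟩
  count (P ∘ (i ∷_)) αs + sum (map (λ i → count (P ∘ (i ∷_)) αs) is)
    ∎
  where open ≡-Reasoning

count-allVecs-suc : ∀ k n (P : List ℕ → Bool) →
  count (P ∘ prefs) (allVecs (suc k) n) ≡ ∑ n (λ a → count (λ α → P (a ∷ prefs α)) (allVecs k n))
count-allVecs-suc k n P =
  trans (count-concatMap-∷ (P ∘ prefs) (allVecs k n) (allFin n))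
        (∑-allFin n (λ a → count (λ α → P (a ∷ prefs α)) (allVecs k n)))

≤⇒<ᵇ≡false : ∀ {a n} → a ≤ n → (n <ᵇ a) ≡ false
≤⇒<ᵇ≡false z≤n       = refl
≤⇒<ᵇ≡false (s≤s a≤n) = ≤⇒<ᵇ≡false a≤n

n<ᵇ1+n : ∀ n → (n <ᵇ suc n) ≡ true
n<ᵇ1+n zero    = refl
n<ᵇ1+n (suc n) = n<ᵇ1+n n

-- p is the only occupied spot; p = 0 encodes the empty lot, as no car prefers spot 0.
nextSpot : ℕ → ℕ → ℕ → Maybe ℕ
nextSpot n p a = if ⌊ p ≟ a ⌋ then (if n <ᵇ suc a then nothing else just (suc a)) else just a

findSpot-single : ∀ n p a → a ≤ n → findSpot n (p ∷ []) a (suc n) ≡ nextSpot n p a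
findSpot-single n p a a≤n rewrite ≤⇒<ᵇ≡false a≤n with p ≟ a
... | no  _    = refl
... | yes refl = findSpot-next n p
  where
  findSpot-next : ∀ n a → findSpot n (a ∷ []) (suc a) n ≡ (if n <ᵇ suc a then nothing else just (suc a))
  findSpot-next zero    a = refl
  findSpot-next (suc n) a with a ≟ suc a
  ... | no  _      = refl
  ... | yes a≡1+a = contradiction (sym a≡1+a) 1+n≢n

nextSpot-≢ : ∀ n {p a} → p ≢ a → nextSpot n p a ≡ just a
nextSpot-≢ n {p} {a} p≢a with p ≟ a
... | yes p≡a = contradiction p≡a p≢a
... | no  _   = refl

nextSpot-self : ∀ {n p} → p < n → nextSpot n p p ≡ just (suc p)
nextSpot-self {n} {p} p<n rewrite ≟-diag {p} refl | ≤⇒<ᵇ≡false p<n = refl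

nextSpot-last : ∀ n → nextSpot n n n ≡ nothing
nextSpot-last n rewrite ≟-diag {n} refl | n<ᵇ1+n n = refl

module OneMetered (n : ℕ) where

  endpoint : ℕ → List ℕ → Maybe ℕ
  endpoint p as = Maybe.map (λ ss → lastSpot (p ∷ ss)) (run 1 n (p ∷ []) as)

  endpoint-∷ : ∀ p a as → a ≤ n → endpoint p (a ∷ as) ≡ (nextSpot n p a >>= λ s → endpoint s as)
  endpoint-∷ p a as a≤n rewrite findSpot-single n p a a≤n with nextSpot n p a
  ... | nothing = refl
  ... | just s with run 1 n (s ∷ []) as
  ...   | nothing = refl
  ...   | just _  = refl

  outcome-from-0 : (α : Vec (Fin n) k) → outcome 1 α ≡ run 1 n (0 ∷ []) (prefs α)
  outcome-from-0 []      = refl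
  outcome-from-0 (i ∷ α) rewrite ≤⇒<ᵇ≡false (toℕ<n i) with run 1 n (suc (toℕ i) ∷ []) (prefs α)
  ... | nothing = refl
  ... | just _  = refl

  isMPF-endpoint : (α : Vec (Fin n) k) → isMPF 1 α ≡ maybe′ (λ _ → true) false (endpoint 0 (prefs α))
  isMPF-endpoint α with outcome 1 α | outcome-from-0 α
  ... | nothing | eq rewrite sym eq = refl
  ... | just _  | eq rewrite sym eq = refl

  isMPFLastAt-endpoint : (α : Vec (Fin n) k) →
    isMPFLastAt 1 α ≡ maybe′ (λ s → ⌊ s ≟ n ⌋) false (endpoint 0 (prefs α))
  isMPFLastAt-endpoint α with outcome 1 α | outcome-from-0 α
  ... | nothing      | eq rewrite sym eq = refl
  ... | just []      | eq rewrite sym eq = refl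
  ... | just (_ ∷ _) | eq rewrite sym eq = refl

  transfer : (ℕ → ℕ) → ℕ → ℕ
  transfer f p = ∑ n (λ a → maybe′ f 0 (nextSpot n p a))

  indicator : (ℕ → Bool) → ℕ → ℕ
  indicator accept s = if accept s then 1 else 0

  count-endpoint : (accept : ℕ → Bool) → ∀ k p →
    count (λ α → maybe′ accept false (endpoint p (prefs α))) (allVecs k n) ≡ fold (indicator accept) transfer k p
  count-endpoint accept zero    p = refl
  count-endpoint accept (suc k) p =
    trans (count-allVecs-suc k n (λ as → maybe′ accept false (endpoint p as)))
          (∑-cong n λ a _ a≤n →
             trans (count-cong (λ α → cong (maybe′ accept false) (endpoint-∷ p a (prefs α) a≤n)) (allVecs k n))
                   (by-next-spot (nextSpot n p a)))
    where
    by-next-spot : ∀ r → count (λ α → maybe′ accept false (r >>= λ s → endpoint s (prefs α))) (allVecs k n)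
                         ≡ maybe′ (fold (indicator accept) transfer k) 0 r
    by-next-spot nothing  = count-false (allVecs k n)
    by-next-spot (just s) = count-endpoint accept k s

  transfer-empty : ∀ f → transfer f 0 ≡ ∑ n f
  transfer-empty f = ∑-cong n (λ a 1≤a _ → cong (maybe′ f 0) (nextSpot-≢ n (<⇒≢ 1≤a)))

  transfer-occupied : ∀ f p → 1 ≤ p → p ≤ n → transfer f p + f p ≡ ∑ n f + maybe′ f 0 (nextSpot n p p)
  transfer-occupied f p 1≤p p≤n =
    ∑-exchange n _ f p 1≤p p≤n (λ a a≢p → cong (maybe′ f 0) (nextSpot-≢ n (a≢p ∘ sym)))

  transfer-interior : ∀ f p → 1 ≤ p → p < n → transfer f p + f p ≡ transfer f 0 + f (suc p)
  transfer-interior f p 1≤p p<n = begin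
    transfer f p + f p                        ≡⟨ transfer-occupied f p 1≤p (<⇒≤ p<n) ⟩
    ∑ n f + maybe′ f 0 (nextSpot n p p)       ≡⟨ cong₂ _+_ (sym (transfer-empty f)) (cong (maybe′ f 0) (nextSpot-self p<n)) ⟩
    transfer f 0 + f (suc p)                  ∎
    where open ≡-Reasoning

  -- Summing transfer-occupied over p: the terms f (p + 1) rebuild ∑ n f except for f 1.
  transfer-total : ∀ f → 1 ≤ n → transfer (transfer f) 0 + f 1 ≡ n * transfer f 0
  transfer-total f 1≤n = +-cancelʳ-≡ (∑ n f) _ _ (begin
    transfer (transfer f) 0 + f 1 + ∑ n f
      ≡⟨ cong (λ s → s + f 1 + ∑ n f) (transfer-empty (transfer f)) ⟩
    ∑ n (transfer f) + f 1 + ∑ n f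
      ≡⟨ right-comm (∑ n (transfer f)) (f 1) (∑ n f) ⟩
    ∑ n (transfer f) + ∑ n f + f 1
      ≡⟨ cong (_+ f 1) (∑-+ n (transfer f) f) ⟨
    ∑ n (λ p → transfer f p + f p) + f 1
      ≡⟨ cong (_+ f 1) (∑-cong n (λ p 1≤p p≤n → transfer-occupied f p 1≤p p≤n)) ⟩
    ∑ n (λ p → ∑ n f + stay p) + f 1
      ≡⟨ cong (_+ f 1) (∑-+ n (λ _ → ∑ n f) stay) ⟩
    ∑ n (λ _ → ∑ n f) + ∑ n stay + f 1
      ≡⟨ +-assoc (∑ n (λ _ → ∑ n f)) _ _ ⟩
    ∑ n (λ _ → ∑ n f) + (∑ n stay + f 1)
      ≡⟨ cong₂ _+_ (∑-const n (∑ n f)) (∑-shift n f stay 1≤n (λ p _ p<n → cong (maybe′ f 0) (nextSpot-self p<n))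
                                                      (cong (maybe′ f 0) (nextSpot-last n))) ⟩
    n * ∑ n f + ∑ n f
      ≡⟨ cong (λ s → n * s + ∑ n f) (transfer-empty f) ⟨
    n * transfer f 0 + ∑ n f
      ∎)
    where
    open ≡-Reasoning
    stay : ℕ → ℕ
    stay p = maybe′ f 0 (nextSpot n p p)
    right-comm : ∀ x y z → x + y + z ≡ x + z + y
    right-comm = solve-∀

  lastAtN allPark : ℕ → ℕ → ℕ
  lastAtN = fold (indicator (λ s → ⌊ s ≟ n ⌋)) transfer
  allPark = fold (λ _ → 1) transfer

  lastAtN-0-≢ : ∀ {p} → p ≢ n → lastAtN 0 p ≡ 0
  lastAtN-0-≢ {p} p≢n with p ≟ n
  ... | yes p≡n = contradiction p≡n p≢n
  ... | no  _   = refl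

  lastAtN-0-n : lastAtN 0 n ≡ 1
  lastAtN-0-n rewrite ≟-diag {n} refl = refl

  mutual
    lastAtN≡allPark-occupied : ∀ k p → 1 ≤ p → 2 + p + k ≤ n → lastAtN (suc k) p ≡ allPark k p
    lastAtN≡allPark-occupied zero p 1≤p h+0 = +-cancelʳ-≡ 0 _ _ (begin
      lastAtN 1 p + 0
        ≡⟨ cong (lastAtN 1 p +_) (lastAtN-0-≢ (<⇒≢ (<⇒≤ h))) ⟨
      lastAtN 1 p + lastAtN 0 p
        ≡⟨ transfer-interior (lastAtN 0) p 1≤p (<⇒≤ h) ⟩
      lastAtN 1 0 + lastAtN 0 (suc p)
        ≡⟨ cong₂ _+_ (lastAtN≡allPark-empty 0 (≤-trans (s≤s z≤n) h)) (lastAtN-0-≢ (<⇒≢ h)) ⟩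
      1 + 0
        ∎)
      where
      open ≡-Reasoning
      h : 2 + p ≤ n
      h = subst (λ x → 2 + x ≤ n) (+-identityʳ p) h+0
    lastAtN≡allPark-occupied (suc k) p 1≤p h+1+k = +-cancelʳ-≡ (allPark k p) _ _ (begin
      lastAtN (2 + k) p + allPark k p
        ≡⟨ cong (lastAtN (2 + k) p +_) (lastAtN≡allPark-occupied k p 1≤p (<⇒≤ h)) ⟨
      lastAtN (2 + k) p + lastAtN (suc k) p
        ≡⟨ transfer-interior (lastAtN (suc k)) p 1≤p p<n ⟩
      lastAtN (2 + k) 0 + lastAtN (suc k) (suc p)
        ≡⟨ cong₂ _+_ (lastAtN≡allPark-empty (suc k) (≤-trans (s≤s (s≤s (m≤n+m k p))) (<⇒≤ h)))
                     (lastAtN≡allPark-occupied k (suc p) (s≤s z≤n) h) ⟩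
      allPark (suc k) 0 + allPark k (suc p)
        ≡⟨ transfer-interior (allPark k) p 1≤p p<n ⟨
      allPark (suc k) p + allPark k p
        ∎)
      where
      open ≡-Reasoning
      h : 3 + p + k ≤ n
      h = subst (λ x → 2 + x ≤ n) (+-suc p k) h+1+k
      p<n : p < n
      p<n = ≤-trans (s≤s (m≤m+n p k)) (<⇒≤ (<⇒≤ h))

    lastAtN≡allPark-empty : ∀ k → k < n → lastAtN (suc k) 0 ≡ allPark k 0
    lastAtN≡allPark-empty zero 0<n = begin
      transfer (lastAtN 0) 0  ≡⟨ transfer-empty (lastAtN 0) ⟩
      ∑ n (lastAtN 0)         ≡⟨ ∑-single n (lastAtN 0) n 0<n ≤-refl (λ _ → lastAtN-0-≢) ⟩
      lastAtN 0 n             ≡⟨ lastAtN-0-n ⟩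
      1                       ∎
      where open ≡-Reasoning
    lastAtN≡allPark-empty (suc zero) 1<n = +-cancelʳ-≡ 0 _ _ (begin
      lastAtN 2 0 + 0             ≡⟨ cong (lastAtN 2 0 +_) (lastAtN-0-≢ (<⇒≢ 1<n)) ⟨
      lastAtN 2 0 + lastAtN 0 1   ≡⟨ transfer-total (lastAtN 0) (<⇒≤ 1<n) ⟩
      n * lastAtN 1 0             ≡⟨ cong (n *_) (lastAtN≡allPark-empty 0 (<⇒≤ 1<n)) ⟩
      n * 1                       ≡⟨ ∑-const n 1 ⟨
      ∑ n (λ _ → 1)               ≡⟨ transfer-empty (allPark 0) ⟨
      allPark 1 0                 ≡⟨ +-identityʳ _ ⟨
      allPark 1 0 + 0             ∎)
      where open ≡-Reasoning
    lastAtN≡allPark-empty (suc (suc k)) h = +-cancelʳ-≡ (allPark k 1) _ _ (begin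
      lastAtN (3 + k) 0 + allPark k 1
        ≡⟨ cong (lastAtN (3 + k) 0 +_) (lastAtN≡allPark-occupied k 1 ≤-refl h) ⟨
      lastAtN (3 + k) 0 + lastAtN (suc k) 1
        ≡⟨ transfer-total (lastAtN (suc k)) 1≤n ⟩
      n * lastAtN (2 + k) 0
        ≡⟨ cong (n *_) (lastAtN≡allPark-empty (suc k) (<⇒≤ h)) ⟩
      n * allPark (suc k) 0
        ≡⟨ transfer-total (allPark k) 1≤n ⟨
      allPark (2 + k) 0 + allPark k 1
        ∎)
      where
      open ≡-Reasoning
      1≤n : 1 ≤ n
      1≤n = ≤-trans (s≤s z≤n) h

  mpfLastAtN≡lastAtN : ∀ m → mpfLastAtN m n 1 ≡ lastAtN m 0
  mpfLastAtN≡lastAtN m =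
    trans (count-cong isMPFLastAt-endpoint (allVecs m n)) (count-endpoint (λ s → ⌊ s ≟ n ⌋) m 0)

  mpf≡allPark : ∀ m → mpf m n 1 ≡ allPark m 0
  mpf≡allPark m = trans (count-cong isMPF-endpoint (allVecs m n)) (count-endpoint (λ _ → true) m 0)

lemma3p10 : (m n : ℕ) → 1 ≤ m → m ≤ n →
    mpfLastAtN m n 1 ≡ mpf (m ∸ 1) n 1
lemma3p10 (suc k) n _ k<n = begin
  mpfLastAtN (suc k) n 1  ≡⟨ mpfLastAtN≡lastAtN (suc k) ⟩
  lastAtN (suc k) 0       ≡⟨ lastAtN≡allPark-empty k k<n ⟩
  allPark k 0             ≡⟨ mpf≡allPark k ⟨
  mpf k n 1               ∎
  where
  open OneMetered n
  open ≡-Reasoning
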